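{- Let $(T,\le)$ be a countable well-founded tree with set of maximal elements $M$, and let $\le'$ be a well-order on $T$ which is a downward-finite extension of $\le$. Let $\alpha$ be the order type of $\le'$ and, for $u\in M$, let $\alpha_u$ be the order type of the restriction of $\le'$ to ${\downarrow}u$. Then $\alpha$ is a left-finite mixed sum of $(\alpha_u)_{u\in M}$.
   Context: A (reversed) well-founded tree is a well-founded partially ordered set $(T,\le)$ such that for every $t\in T$ the set $\{s\in T\mid s>t\}$ is finite and linearly ordered. ${\downarrow}t=\{u\in T\mid u\le t\}$; for another order $\le'$, ${\downarrow}'t=\{u\mid u\le' t\}$. An order $\le'$ on $T$ is a downward-finite extension of $\le$ if $u\le t$ implies $u\le' t$, and for every $v\in T$ there are finitely many elements $u_0,\dots,u_n\in T$, each $\le$-incomparable with $v$, with ${\downarrow}'v\subseteq{\downarrow}v\cup{\downarrow}u_0\cup\dots\cup{\downarrow}u_n$. An ordinal $\beta$ is a mixed sum of $(\alpha_i)_{i\in I}$ if there are pairwise disjoint $A_i\subseteq\beta$ with $\bigcup_iA_i=\beta$ and each $A_i$ of order type $\alpha_i$ in the induced order; it is a left-finite mixed sum if this can be done so that for every $a\in\beta$ the set $\{b\in\beta\mid b<a\}$ is contained in the union of finitely many $A_i$. -}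

module Defs where

open import Level using (0ℓ)
open import Data.Nat using (ℕ)
open import Data.Product using (Σ; Σ-syntax; ∃; ∃-syntax; _×_; _,_; proj₁; proj₂)
open import Data.Sum using (_⊎_)
open import Data.List using (List)
open import Data.List.Relation.Unary.All using (All)
open import Data.List.Relation.Unary.Any using (Any)
open import Relation.Nullary using (¬_)
open import Relation.Binary.PropositionalEquality using (_≡_; _≢_)
open import Relation.Binary.Definitions using (Transitive)
open import Relation.Binary.Structures using (IsPartialOrder; IsTotalOrder)
open import Induction.WellFounded using (WellFounded)
open import Function.Definitions using (Injective)

Strict : {T : Set} → (T → T → Set) → T → T → Set
Strict _≤_ x y = (x ≤ y) × (x ≢ y)

-- A (reversed) well-founded tree: a well-founded partial order in which
-- every set of strict upper bounds {s | s > t} is finite and linearly ordered.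
-- "finite" = contained in (the elements of) some finite list.
record IsWFTree {T : Set} (_≤_ : T → T → Set) : Set where
  field
    isPartialOrder : IsPartialOrder _≡_ _≤_
    wellFounded    : WellFounded (Strict _≤_)
    upFinite       : ∀ t → ∃[ xs ] (∀ s → Strict _≤_ t s → Any (s ≡_) xs)
    upLinear       : ∀ t s s′ → Strict _≤_ t s → Strict _≤_ t s′ →
                     (s ≤ s′) ⊎ (s′ ≤ s)

Countable : Set → Set
Countable T = Σ (T → ℕ) λ f → Injective _≡_ _≡_ f

record IsWellOrder {T : Set} (_≤_ : T → T → Set) : Set where
  field
    isTotalOrder : IsTotalOrder _≡_ _≤_
    wellFounded  : WellFounded (Strict _≤_)

Maximal : {T : Set} → (T → T → Set) → T → Set
Maximal _≤_ u = ∀ s → u ≤ s → s ≡ u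

Down : {T : Set} → (T → T → Set) → T → T → Set
Down _≤_ t u = u ≤ t

Incomparable : {T : Set} → (T → T → Set) → T → T → Set
Incomparable _≤_ u v = ¬ (u ≤ v) × ¬ (v ≤ u)

record IsDownwardFiniteExtension {T : Set} (_≤_ _≤′_ : T → T → Set) : Set where
  field
    extends     : ∀ {u t} → u ≤ t → u ≤′ t
    downFinite  : ∀ v → ∃[ us ] (All (λ u → Incomparable _≤_ u v) us ×
                   (∀ w → w ≤′ v → (w ≤ v) ⊎ Any (λ u → w ≤ u) us))

-- The subsets P and Q of T, both ordered by the restriction of ≤′,
-- have the same order type (an order isomorphism between them).
record OrderIso {T : Set} (_≤′_ : T → T → Set) (P Q : T → Set) : Set where
  field
    to      : Σ T P → Σ T Q
    from    : Σ T Q → Σ T P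
    from∘to : ∀ x → proj₁ (from (to x)) ≡ proj₁ x
    to∘from : ∀ y → proj₁ (to (from y)) ≡ proj₁ y
    mono    : ∀ x y → proj₁ x ≤′ proj₁ y → proj₁ (to x) ≤′ proj₁ (to y)
    reflect : ∀ x y → proj₁ (to x) ≤′ proj₁ (to y) → proj₁ x ≤′ proj₁ y

-- (T, ≤′) (of order type α) is a left-finite mixed sum of the order types
-- α_u of (↓u, ≤′) for u ranging over the maximal elements M of (T, ≤):
-- a partition (A_u)_{u ∈ M} of T such that each (A_u, ≤′) has order type α_u,
-- and for every a, {b | b <′ a} is covered by finitely many A_u.
IsLeftFiniteMixedSum : {T : Set} (_≤_ _≤′_ : T → T → Set) → Set₁
IsLeftFiniteMixedSum {T} _≤_ _≤′_ =
  Σ[ A ∈ (Σ T (Maximal _≤_) → T → Set) ]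
    ( (∀ i j t → A i t → A j t → proj₁ i ≡ proj₁ j)
    × (∀ t → ∃[ i ] A i t)
    × (∀ i → OrderIso _≤′_ (A i) (Down _≤_ (proj₁ i)))
    × (∀ a → ∃[ is ] (∀ b → Strict _≤′_ b a → Any (λ i → A i b) is)) )

-- In a reversed tree every element t lies below exactly one maximal element:
-- one exists because the finitely many strict upper bounds of t are climbed
-- in finitely many steps, and it is unique because these upper bounds form a
-- chain. So the down-sets ↓u, u ∈ M, partition T, and taking A_u = ↓u makes
-- each A_u of order type α_u by the identity map. Left-finiteness is then
-- the downward-finiteness of ≤′: ↓′a ⊆ ↓a ∪ ↓u₀ ∪ … ∪ ↓uₙ, and each of these
-- down-sets lies inside the block of the maximal element above it.
module Submission where

open import Defs
open import Axiom.ExcludedMiddle using (ExcludedMiddle)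
open import Level using (0ℓ)
open import Data.List using (List; _∷_; filter; length; map)
open import Data.List.Properties using (filter-notAll)
open import Data.List.Membership.Propositional using (_∈_)
open import Data.List.Membership.Propositional.Properties using (∈-filter⁺)
open import Data.List.Relation.Unary.Any as Any using (Any; here; there)
open import Data.List.Relation.Unary.Any.Properties using (map⁺)
open import Data.Nat.Base using (_<_)
open import Data.Nat.Induction using (<-wellFounded)
open import Data.Product using (Σ; ∃-syntax; _×_; _,_; proj₁; proj₂)
open import Data.Sum using (_⊎_; inj₁; inj₂)
open import Function.Base using (_on_; _∘_; id)
open import Induction.WellFounded using (Acc; acc)
open import Relation.Binary.PropositionalEquality using (_≡_; _≢_; refl; sym)
open import Relation.Binary.Structures using (IsPartialOrder)
open import Relation.Nullary using (¬_; Dec; yes; no; contradiction)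
import Relation.Binary.Construct.NonStrictToStrict as NonStrictToStrict
import Relation.Binary.Construct.On as On

OrderIso-refl : {T : Set} (_≤′_ : T → T → Set) (P : T → Set) → OrderIso _≤′_ P P
OrderIso-refl _≤′_ P = record
  { to = id ; from = id ; from∘to = λ _ → refl ; to∘from = λ _ → refl
  ; mono = λ _ _ → id ; reflect = λ _ _ → id }

module _ {T : Set} {_≤_ : T → T → Set} (em : ExcludedMiddle 0ℓ) where

  maximal-if-no-strict-upper-bound : ∀ {t} → ¬ (∃[ s ] Strict _≤_ t s) → Maximal _≤_ t
  maximal-if-no-strict-upper-bound {t} ∄s s t≤s with em {s ≡ t}
  ... | yes s≡t = s≡t
  ... | no  s≢t = contradiction (s , t≤s , s≢t ∘ sym) ∄s

  module _ (isPartialOrder : IsPartialOrder _≡_ _≤_)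
           (upFinite : ∀ t → ∃[ xs ] (∀ s → Strict _≤_ t s → s ∈ xs)) where

    open IsPartialOrder isPartialOrder using () renaming (refl to ≤-refl; trans to ≤-trans)
    open NonStrictToStrict _≡_ _≤_ using (<-trans)

    maximal-above : ∀ t → ∃[ m ] Maximal _≤_ m × t ≤ m
    maximal-above t =
      climb t (proj₁ (upFinite t)) (proj₂ (upFinite t)) (On.wellFounded length <-wellFounded _)
      where
      -- Moving up from t to s, the strict upper bounds of s are still covered
      -- by the list for t with s removed, so the list gets shorter.
      climb : ∀ t xs → (∀ s → Strict _≤_ t s → s ∈ xs) → Acc (_<_ on length) xs →
              ∃[ m ] Maximal _≤_ m × t ≤ m
      climb t xs above (acc shorter) with em {∃[ s ] Strict _≤_ t s}
      ... | no ∄s = t , maximal-if-no-strict-upper-bound ∄s , ≤-refl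
      ... | yes (s , t<s) =
        let m , m-maximal , s≤m = climb s (filter s≢? xs) above-s (shorter drops-s)
        in  m , m-maximal , ≤-trans (proj₁ t<s) s≤m
        where
        s≢? : ∀ u → Dec (s ≢ u)
        s≢? u = em
        above-s : ∀ u → Strict _≤_ s u → u ∈ filter s≢? xs
        above-s u s<u = ∈-filter⁺ s≢? (above u (<-trans isPartialOrder t<s s<u)) (proj₂ s<u)
        drops-s : length (filter s≢? xs) < length xs
        drops-s = filter-notAll s≢? xs (Any.map (λ s≡u s≢u → s≢u s≡u) (above s t<s))

  module _ (upLinear : ∀ t s s′ → Strict _≤_ t s → Strict _≤_ t s′ → (s ≤ s′) ⊎ (s′ ≤ s)) where

    maximal-above-unique : ∀ {t m m′} → Maximal _≤_ m → Maximal _≤_ m′ →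
                           t ≤ m → t ≤ m′ → m ≡ m′
    maximal-above-unique {t} {m} {m′} m-maximal m′-maximal t≤m t≤m′
      with em {t ≡ m} | em {t ≡ m′}
    ... | yes refl | _        = sym (m-maximal m′ t≤m′)
    ... | no  _    | yes refl = m′-maximal m t≤m
    ... | no  t≢m  | no  t≢m′ with upLinear t m m′ (t≤m , t≢m) (t≤m′ , t≢m′)
    ...   | inj₁ m≤m′ = sym (m-maximal m′ m≤m′)
    ...   | inj₂ m′≤m = m′-maximal m m′≤m

module Forest {T : Set} {_≤_ : T → T → Set} (em : ExcludedMiddle 0ℓ) (tree : IsWFTree _≤_) where

  open IsWFTree tree
  open IsPartialOrder isPartialOrder using () renaming (trans to ≤-trans)

  root : T → Σ T (Maximal _≤_)
  root t = let m , m-maximal , _ = maximal-above em isPartialOrder upFinite t in m , m-maximal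

  ≤-root : ∀ t → t ≤ proj₁ (root t)
  ≤-root t = proj₂ (proj₂ (maximal-above em isPartialOrder upFinite t))

  Block : Σ T (Maximal _≤_) → T → Set
  Block = Down _≤_ ∘ proj₁

  blocks-disjoint : ∀ i j t → Block i t → Block j t → proj₁ i ≡ proj₁ j
  blocks-disjoint (_ , i-maximal) (_ , j-maximal) _ =
    maximal-above-unique em upLinear i-maximal j-maximal

  blocks-cover : ∀ t → ∃[ i ] Block i t
  blocks-cover t = root t , ≤-root t

  down-sets-in-blocks : ∀ {b} (us : List T) → Any (b ≤_) us → Any (λ i → Block i b) (map root us)
  down-sets-in-blocks us = map⁺ ∘ Any.map (λ {u} b≤u → ≤-trans b≤u (≤-root u))

  finitely-many-blocks-cover-down′ : ∀ {_≤′_ : T → T → Set} → IsDownwardFiniteExtension _≤_ _≤′_ →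
    ∀ a → ∃[ is ] (∀ b → b ≤′ a → Any (λ i → Block i b) is)
  finitely-many-blocks-cover-down′ {_≤′_} extension a = root a ∷ map root us , covered
    where
    open IsDownwardFiniteExtension extension using (downFinite)
    us : List T
    us = proj₁ (downFinite a)
    covered : ∀ b → b ≤′ a → Any (λ i → Block i b) (root a ∷ map root us)
    covered b b≤′a with proj₂ (proj₂ (downFinite a)) b b≤′a
    ... | inj₁ b≤a      = here (≤-trans b≤a (≤-root a))
    ... | inj₂ b≤some-u = there (down-sets-in-blocks us b≤some-u)

lemma6p7 : ExcludedMiddle 0ℓ →
    (T : Set) (_≤_ _≤′_ : T → T → Set) →
    Countable T → IsWFTree _≤_ → IsWellOrder _≤′_ →
    IsDownwardFiniteExtension _≤_ _≤′_ →
    IsLeftFiniteMixedSum _≤_ _≤′_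
lemma6p7 em T _≤_ _≤′_ _ tree _ extension =
  Block , blocks-disjoint , blocks-cover , (λ i → OrderIso-refl _≤′_ (Block i)) , left-finite
  where
  open Forest em tree
  left-finite : ∀ a → ∃[ is ] (∀ b → Strict _≤′_ b a → Any (λ i → Block i b) is)
  left-finite a = let is , covered = finitely-many-blocks-cover-down′ extension a
                  in  is , λ b → covered b ∘ proj₁
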